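{- A primed $\lambda$-toppler (any integer $\lambda\ge2$, any initial state $q\in\{1,\dots,\lambda-1\}$) can be emulated by a directed acyclic abelian network consisting of one unprimed $\lambda$-toppler, adders, splitters, and a presink.
   Context: $\mathbb{N}=\{0,1,2,\dots\}$. For an integer $\lambda\ge2$, a $\lambda$-toppler has one input, one output and states $0,\dots,\lambda-1$: a letter received in state $q<\lambda-1$ moves it to $q+1$ emitting nothing; a letter received in state $\lambda-1$ moves it to $0$ and emits one letter. Started in state $q$ it computes $x\mapsto\lfloor (x+q)/\lambda\rfloor$; it is unprimed if started in $0$ and primed otherwise. A presink (started in state $0$) has states $0,1$: in state $0$ a letter moves it to state $1$ and it emits one letter, in state $1$ letters are ignored; it computes $x\mapsto\min(x,1)$. An adder (two inputs, one output) computes $(x,y)\mapsto x+y$; a splitter (one input, two outputs) computes $x\mapsto(x,x)$. An abelian network is a finite directed multigraph with dangling input edges and output/trash edges, each node carrying such a processor; it runs by repeatedly feeding a waiting letter on any non-output, non-trash edge into the node at its head, halting when all letters are on output or trash edges, and (when it halts on all inputs) computes the resulting input-output function. It emulates a processor if it computes the same function; it is directed acyclic if its graph has no directed cycle. -}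

module Defs where

open import Data.Nat using (ℕ; zero; suc; _+_; _⊓_; NonZero)
open import Data.Nat.DivMod using (_/_)
open import Data.Fin using (Fin)
open import Data.Vec using (Vec; []; _∷_; _++_; lookup; removeAt)
open import Data.Product using (_×_; _,_)
open import Data.Unit using (⊤; tt)
open import Data.List using (List; []; _∷_) renaming (_++_ to _++ˡ_)

toppleFn : (l q : ℕ) → .{{NonZero l}} → ℕ → ℕ
toppleFn l q x = (x + q) / l

data Node : ℕ → ℕ → Set where
  toppler  : (l q : ℕ) → .{{NonZero l}} → Node 1 1
  presink  : Node 1 1
  adder    : Node 2 1
  splitter : Node 1 2

-- Input-output function of a node (counts of letters on each edge).
⟦_⟧ : ∀ {i o} → Node i o → Vec ℕ i → Vec ℕ o
⟦ toppler l q ⟧ (x ∷ []) = toppleFn l q x ∷ []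
⟦ presink ⟧ (x ∷ []) = (x ⊓ 1) ∷ []
⟦ adder ⟧ (x ∷ y ∷ []) = (x + y) ∷ []
⟦ splitter ⟧ (x ∷ []) = x ∷ x ∷ []

-- Choosing i distinct dangling edges out of i + m, one after another.
Picks : ℕ → ℕ → Set
Picks zero m = ⊤
Picks (suc i) m = Fin (suc (i + m)) × Picks i m

pick : ∀ {i m} → Vec ℕ (i + m) → Picks i m → Vec ℕ i × Vec ℕ m
pick {zero} v tt = [] , v
pick {suc i} v (k , ps) with pick {i} (removeAt v k) ps
... | (ins , rest) = (lookup v k ∷ ins) , rest

-- A directed acyclic abelian network, given in topological order.
-- Net n: the remaining network when n edges are currently dangling
-- (not yet attached to a head).  'step' adds a node whose input edges are
-- i of the dangling edges; its o output edges become dangling.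
-- 'done k' declares dangling edge k the output edge; all other dangling
-- edges are trash edges.
data Net : ℕ → Set where
  done : ∀ {n} → Fin n → Net n
  step : ∀ {i o m} → Node i o → Picks i m → Net (o + m) → Net (i + m)

-- Final letter counts on edges (for a DAG the halting output is the
-- composition of the node functions in topological order).
eval : ∀ {n} → Net n → Vec ℕ n → ℕ
eval (done k) v = lookup v k
eval (step nd ps N) v with pick v ps
... | (ins , rest) = eval N (⟦ nd ⟧ ins ++ rest)

run : Net 1 → ℕ → ℕ
run N x = eval N (x ∷ [])

topplers : ∀ {n} → Net n → List (ℕ × ℕ)
topplers (done _) = []
topplers (step (toppler l q) _ N) = (l , q) ∷ topplers N
topplers (step presink _ N) = topplers N
topplers (step adder _ N) = topplers N
topplers (step splitter _ N) = topplers N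

presinks : ∀ {n} → Net n → ℕ
presinks (done _) = 0
presinks (step presink _ N) = suc (presinks N)
presinks (step (toppler _ _) _ N) = presinks N
presinks (step adder _ N) = presinks N
presinks (step splitter _ N) = presinks N

{-# OPTIONS --safe #-}
module Submission where

-- A toppler primed in state q behaves like an unprimed one that receives q
-- extra letters together with the first letter; on empty input neither fires,
-- since q < λ.  The presink detects the first letter by emitting min(x, 1),
-- and q splitter/adder stages add that signal q times to the input before it
-- reaches the unprimed toppler.

open import Defs
open import Data.Nat using (ℕ; zero; suc; _+_; _*_; _⊓_; _≤_; _<_; NonZero)
open import Data.Nat.Properties using (+-assoc; +-identityʳ; *-identityʳ; *-zeroʳ; ⊓-zeroʳ)
open import Data.Nat.DivMod using (_/_; m<n⇒m/n≡0; 0/n≡0)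
open import Data.Fin using () renaming (zero to fz; suc to fs)
open import Data.Vec using ([]; _∷_)
open import Data.Product using (Σ; _×_; _,_)
open import Data.Unit using (tt)
open import Data.List using ([]; _∷_)
open import Relation.Binary.PropositionalEquality using (_≡_; refl; sym; cong)
open Relation.Binary.PropositionalEquality.≡-Reasoning

toppleFn-primed : (l q x : ℕ) → .{{_ : NonZero l}} → q < l →
                  toppleFn l q x ≡ toppleFn l 0 (x + q * (x ⊓ 1))
toppleFn-primed l q zero    q<l rewrite *-zeroʳ q = begin
  q / l ≡⟨ m<n⇒m/n≡0 q<l ⟩
  0     ≡⟨ sym (0/n≡0 l) ⟩
  0 / l ∎
toppleFn-primed l q (suc y) q<l = cong (_/ l) (begin
  suc y + q                   ≡⟨ cong (suc y +_) (sym (*-identityʳ q)) ⟩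
  suc y + q * 1               ≡⟨ cong (λ m → suc y + q * suc m) (sym (⊓-zeroʳ y)) ⟩
  suc y + q * (suc y ⊓ 1)     ≡⟨ sym (+-identityʳ _) ⟩
  suc y + q * (suc y ⊓ 1) + 0 ∎)

addCopies : ℕ → Net 2 → Net 2
addCopies zero    N = N
addCopies (suc k) N =
  step splitter (fs fz , tt) (step adder (fs (fs fz) , fz , tt) (addCopies k N))

eval-addCopies : (k : ℕ) (N : Net 2) (a p : ℕ) →
                 eval (addCopies k N) (a ∷ p ∷ []) ≡ eval N (a + k * p ∷ p ∷ [])
eval-addCopies zero    N a p = cong (λ b → eval N (b ∷ p ∷ [])) (sym (+-identityʳ a))
eval-addCopies (suc k) N a p = begin
  eval (addCopies k N) (a + p ∷ p ∷ [])   ≡⟨ eval-addCopies k N (a + p) p ⟩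
  eval N (a + p + k * p ∷ p ∷ [])         ≡⟨ cong (λ b → eval N (b ∷ p ∷ [])) (+-assoc a p (k * p)) ⟩
  eval N (a + suc k * p ∷ p ∷ [])         ∎

topplers-addCopies : (k : ℕ) (N : Net 2) → topplers (addCopies k N) ≡ topplers N
topplers-addCopies zero    N = refl
topplers-addCopies (suc k) N = topplers-addCopies k N

presinks-addCopies : (k : ℕ) (N : Net 2) → presinks (addCopies k N) ≡ presinks N
presinks-addCopies zero    N = refl
presinks-addCopies (suc k) N = presinks-addCopies k N

unprimedOnFirst : (l : ℕ) → .{{_ : NonZero l}} → Net 2
unprimedOnFirst l = step (toppler l 0) (fz , tt) (done fz)

-- Splits x, turns one copy into m = min(x, 1), adds m once while moving it to
-- the second edge, then k more times.
emulator : (l k : ℕ) → .{{_ : NonZero l}} → Net 1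
emulator l k =
  step splitter (fz , tt) (step presink (fz , tt)
    (step splitter (fz , tt) (step adder (fs (fs fz) , fz , tt)
      (addCopies k (unprimedOnFirst l)))))

run-emulator : (l k x : ℕ) → .{{_ : NonZero l}} →
               run (emulator l k) x ≡ toppleFn l 0 (x + suc k * (x ⊓ 1))
run-emulator l k x = begin
  eval (addCopies k (unprimedOnFirst l)) (x + x ⊓ 1 ∷ x ⊓ 1 ∷ [])
    ≡⟨ eval-addCopies k _ (x + x ⊓ 1) (x ⊓ 1) ⟩
  toppleFn l 0 (x + x ⊓ 1 + k * (x ⊓ 1))
    ≡⟨ cong (toppleFn l 0) (+-assoc x (x ⊓ 1) (k * (x ⊓ 1))) ⟩
  toppleFn l 0 (x + suc k * (x ⊓ 1)) ∎

lemma3p1 : (l q : ℕ) → .{{_ : NonZero l}} → 2 ≤ l → 1 ≤ q → q < l →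
    Σ (Net 1) λ N →
    (topplers N ≡ (l , 0) ∷ []) × (presinks N ≡ 1) ×
    ((x : ℕ) → run N x ≡ toppleFn l q x)
lemma3p1 l (suc k) _ _ q<l =
  emulator l k ,
  topplers-addCopies k (unprimedOnFirst l) ,
  cong suc (presinks-addCopies k (unprimedOnFirst l)) ,
  λ x → begin
    run (emulator l k) x                 ≡⟨ run-emulator l k x ⟩
    toppleFn l 0 (x + suc k * (x ⊓ 1))   ≡⟨ sym (toppleFn-primed l (suc k) x q<l) ⟩
    toppleFn l (suc k) x                 ∎
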